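{- $S_n(3\mathrm{ - }\bar{1}\mathrm{ - }42,\ \bar{2}\mathrm{ - }41\mathrm{ - }3)$ is exactly the set of layered permutations in $\mathfrak{S}_n$.
   Context: $\sigma$ contains $3\mathrm{ - }\bar{1}\mathrm{ - }42$ if there are $i<j<n$ with $\sigma_{j+1}<\sigma_i<\sigma_j$ and no $k$ with $i<k<j$, $\sigma_k<\sigma_{j+1}$. $\sigma$ contains $\bar{2}\mathrm{ - }41\mathrm{ - }3$ if there are $j<j+1<l$ with $\sigma_{j+1}<\sigma_l<\sigma_j$ and no $i<j$ with $\sigma_{j+1}<\sigma_i<\sigma_l$. $S_n(\cdot,\cdot)$ is the set of $\sigma\in\mathfrak{S}_n$ avoiding both. For a composition $\gamma=(\gamma_1,\dots,\gamma_m)$ of $n$, the layered permutation $\pi_\gamma$ is $\gamma_1(\gamma_1-1)\cdots1\;(\gamma_1+\gamma_2)\cdots(\gamma_1+1)\;\cdots\;n(n-1)\cdots(\gamma_1+\dots+\gamma_{m-1}+1)$, i.e. a concatenation of decreasing blocks of consecutive values, with the blocks' values increasing from left to right. -}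

module Defs where

open import Data.Nat using (ℕ; zero; suc; _+_; _∸_; _<_; _<ᵇ_; _≤_)
open import Data.Bool using (if_then_else_)
open import Data.Fin using (Fin; toℕ)
open import Data.Fin.Permutation using (Permutation′; _⟨$⟩ʳ_)
open import Data.List using (List; []; _∷_)
open import Data.Nat.ListAction using (sum)
open import Data.List.Relation.Unary.All using (All)
open import Data.Product using (Σ; ∃; _×_; _,_)
open import Relation.Binary.PropositionalEquality using (_≡_)
open import Relation.Nullary using (¬_)

-- Positions and values are 0-indexed (Fin n); patterns only compare them, so
-- this is equivalent to the paper's 1-indexed convention.

val : ∀ {n} → Permutation′ n → Fin n → ℕ
val σ p = toℕ (σ ⟨$⟩ʳ p)

Contains-3-1b-42 : ∀ {n} → Permutation′ n → Set
Contains-3-1b-42 {n} σ =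
  Σ (Fin n) λ i → Σ (Fin n) λ j → Σ (Fin n) λ j' →
    toℕ j' ≡ suc (toℕ j) × toℕ i < toℕ j ×
    val σ j' < val σ i × val σ i < val σ j ×
    ¬ (Σ (Fin n) λ k → toℕ i < toℕ k × toℕ k < toℕ j × val σ k < val σ j')

Contains-2b-41-3 : ∀ {n} → Permutation′ n → Set
Contains-2b-41-3 {n} σ =
  Σ (Fin n) λ j → Σ (Fin n) λ j' → Σ (Fin n) λ l →
    toℕ j' ≡ suc (toℕ j) × toℕ j' < toℕ l ×
    val σ j' < val σ l × val σ l < val σ j ×
    ¬ (Σ (Fin n) λ i → toℕ i < toℕ j × val σ j' < val σ i × val σ i < val σ l)

AvoidsBoth : ∀ {n} → Permutation′ n → Set
AvoidsBoth σ = ¬ Contains-3-1b-42 σ × ¬ Contains-2b-41-3 σ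

IsComposition : ℕ → List ℕ → Set
IsComposition n γ = All (λ g → 0 < g) γ × sum γ ≡ n

-- Block g occupies positions 0..g-1 with values o+g-1, ..., o.
layeredAt : List ℕ → ℕ → ℕ → ℕ
layeredAt []       o p = p
layeredAt (g ∷ γ) o p =
  if p <ᵇ g then o + (g ∸ 1 ∸ p) else layeredAt γ (o + g) (p ∸ g)

layered : List ℕ → ℕ → ℕ
layered γ p = layeredAt γ 0 p

IsLayered : ∀ {n} → Permutation′ n → Set
IsLayered {n} σ =
  Σ (List ℕ) λ γ → IsComposition n γ × (∀ (p : Fin n) → val σ p ≡ layered γ (toℕ p))

module Submission where

-- Both patterns put some entry strictly between the two entries of a descent
-- σ_{j+1} < σ_j, and conversely, if some value lies strictly inside a descent,
-- then by strong induction on j one of the two patterns occurs: a witness left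
-- of j gives a 3-1̄-42 unless an entry in between dips below σ_{j+1}, and then
-- an earlier descent already has σ_{j+1} inside it; a witness right of j+1
-- gives a 2̄-41-3 unless there is also a witness left of j.  So σ avoids both
-- patterns iff every descent drops by exactly one.  Such a permutation is
-- layered: reading leftwards from the position q of the smallest value, each
-- entry exceeds all the values already seen, hence is a descent and so one
-- more than its right neighbour; thus σ_1 … σ_q is the first layer, and the
-- remaining entries again drop by one at every descent.

open import Data.Bool using (true; false)
open import Data.Empty using (⊥; ⊥-elim)
open import Data.Fin using (toℕ; fromℕ<)
open import Data.Fin.Permutation using (Permutation′; _⟨$⟩ʳ_; _⟨$⟩ˡ_; inverseˡ; inverseʳ)
open import Data.Fin.Properties using (toℕ<n; toℕ-fromℕ<; fromℕ<-toℕ; toℕ-injective)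
open import Data.List using (List; []; _∷_)
open import Data.List.Relation.Unary.All using (All; []; _∷_)
open import Data.Nat
open import Data.Nat.Induction using (<-rec; <-wellFounded)
open import Data.Nat.ListAction using (sum)
open import Data.Nat.Properties
open import Data.Product using (Σ; ∃-syntax; _×_; _,_; proj₁; proj₂)
open import Data.Sum using (inj₁; inj₂)
open import Defs
open import Function using (_∘_)
open import Function.Bundles using (_⇔_; mk⇔)
open import Induction.WellFounded using (Acc; acc)
open import Relation.Binary.Definitions using (tri<; tri≈; tri>)
open import Relation.Binary.PropositionalEquality
open import Relation.Nullary using (¬_; yes; no)

InjectiveBelow : ℕ → (ℕ → ℕ) → Set
InjectiveBelow N f = ∀ {p q} → p < N → q < N → f p ≡ f q → p ≡ q

record IsIntervalBijection (N o : ℕ) (f : ℕ → ℕ) : Set where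
  field
    bounded    : ∀ {p} → p < N → o ≤ f p × f p < o + N
    injective  : InjectiveBelow N f
    surjective : ∀ {v} → o ≤ v → v < o + N → ∃[ p ] p < N × f p ≡ v

Contains-3-1b-42′ : ℕ → (ℕ → ℕ) → Set
Contains-3-1b-42′ N f = Σ ℕ λ i → Σ ℕ λ j →
  suc j < N × i < j × f (suc j) < f i × f i < f j ×
  ¬ (Σ ℕ λ k → i < k × k < j × f k < f (suc j))

Contains-2b-41-3′ : ℕ → (ℕ → ℕ) → Set
Contains-2b-41-3′ N f = Σ ℕ λ j → Σ ℕ λ l →
  suc j < l × l < N × f (suc j) < f l × f l < f j ×
  ¬ (Σ ℕ λ i → i < j × f (suc j) < f i × f i < f l)

GapFreeDescents : ℕ → (ℕ → ℕ) → Set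
GapFreeDescents N f =
  ∀ {j p} → suc j < N → p < N → f (suc j) < f p → f p < f j → ⊥

UnitDescents : ℕ → (ℕ → ℕ) → Set
UnitDescents N f = ∀ {j} → suc j < N → f (suc j) < f j → f j ≡ suc (f (suc j))

unitDescents⇒gapFree : ∀ {N f} → UnitDescents N f → GapFreeDescents N f
unitDescents⇒gapFree {f = f} unit {p = p} sj<N _ below above =
  <⇒≱ below (s≤s⁻¹ (subst (f p <_) (unit sj<N (<-trans below above)) above))

gapFree⇒unitDescents : ∀ {N o f} → IsIntervalBijection N o f →
  GapFreeDescents N f → UnitDescents N f
gapFree⇒unitDescents {f = f} bij gapFree {j} sj<N desc with m≤n⇒m<n∨m≡n desc
... | inj₂ fj≡ = sym fj≡
... | inj₁ inside =
  let open IsIntervalBijection bij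
      p , p<N , fp≡ = surjective (m≤n⇒m≤1+n (proj₁ (bounded sj<N)))
                                 (<-trans inside (proj₂ (bounded (<-trans (n<1+n j) sj<N))))
  in  ⊥-elim (gapFree sj<N p<N (subst (f (suc j) <_) (sym fp≡) ≤-refl)
                                 (subst (_< f j) (sym fp≡) inside))

descent-across : ∀ (f : ℕ → ℕ) b {i k} → i ≤ k → b ≤ f i → f k < b →
  ∃[ m ] i ≤ m × m < k × b ≤ f m × f (suc m) < b
descent-across f b {k = zero}  z≤n b≤fi fk<b = ⊥-elim (<⇒≱ fk<b b≤fi)
descent-across f b {k = suc k} i≤k b≤fi fk<b with m≤n⇒m<n∨m≡n i≤k
... | inj₂ refl = ⊥-elim (<⇒≱ fk<b b≤fi)
... | inj₁ (s≤s i≤k′) with f k <? b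
...   | no fk≮b = k , i≤k′ , ≤-refl , ≮⇒≥ fk≮b , fk<b
...   | yes fk<b′ =
  let m , i≤m , m<k , crossing = descent-across f b i≤k′ b≤fi fk<b′
  in  m , i≤m , m<n⇒m<1+n m<k , crossing

avoiding⇒gapFree : ∀ {N f} → InjectiveBelow N f →
  ¬ Contains-3-1b-42′ N f → ¬ Contains-2b-41-3′ N f → GapFreeDescents N f
avoiding⇒gapFree {N} {f} injective no-3-1b-42 no-2b-41-3 {j} = <-rec Gap step j
  where
  Gap : ℕ → Set
  Gap j = ∀ {p} → suc j < N → p < N → f (suc j) < f p → f p < f j → ⊥

  noWitnessLeft : ∀ {i j} → (∀ {m} → m < j → Gap m) → suc j < N →
    i < j → f (suc j) < f i → f i < f j → ⊥
  noWitnessLeft {i} {j} earlier sj<N i<j below above =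
    no-3-1b-42 (i , j , sj<N , i<j , below , above , noDip)
    where
    noDip : ¬ (Σ ℕ λ k → i < k × k < j × f k < f (suc j))
    noDip (k , i<k , k<j , dip) =
      let m , _ , m<k , fsj≤fm , fsm<fsj = descent-across f (f (suc j)) (<⇒≤ i<k) (<⇒≤ below) dip
          m<j = <-trans m<k k<j
          j<N = <-trans (n<1+n j) sj<N
          fsj≢fm = λ eq → <⇒≢ (m<n⇒m<1+n m<j) (sym (injective sj<N (<-trans m<j j<N) eq))
      in  earlier m<j (≤-<-trans m<j j<N) sj<N fsm<fsj (≤∧≢⇒< fsj≤fm fsj≢fm)

  step : ∀ j → (∀ {m} → m < j → Gap m) → Gap j
  step j earlier {p} sj<N p<N below above with <-cmp p j
  ... | tri< p<j _ _  = noWitnessLeft earlier sj<N p<j below above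
  ... | tri≈ _ refl _ = <-irrefl refl above
  ... | tri> _ _ j<p with m≤n⇒m<n∨m≡n j<p
  ...   | inj₂ refl = <-irrefl refl below
  ...   | inj₁ sj<p = no-2b-41-3 (j , p , sj<p , p<N , below , above ,
                        λ (i , i<j , below′ , above′) →
                          noWitnessLeft earlier sj<N i<j below′ (<-trans above′ above))

m<n+o∧n≤m⇒m∸n<o : ∀ {m n o} → m < n + o → n ≤ m → m ∸ n < o
m<n+o∧n≤m⇒m∸n<o {m} {n} {o} m<n+o n≤m = subst (m ∸ n <_) (m+n∸m≡n n o) (∸-monoˡ-< m<n+o n≤m)

layeredAt-head : ∀ g γ {o p} → p < g → layeredAt (g ∷ γ) o p ≡ o + (g ∸ 1 ∸ p)
layeredAt-head g γ {p = p} p<g with p <ᵇ g | <⇒<ᵇ p<g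
... | true | _ = refl

layeredAt-tail : ∀ g γ {o p} → g ≤ p → layeredAt (g ∷ γ) o p ≡ layeredAt γ (o + g) (p ∸ g)
layeredAt-tail g γ {p = p} g≤p with p <ᵇ g | <ᵇ⇒< p g
... | false | _   = refl
... | true  | p<g = ⊥-elim (<⇒≱ (p<g _) g≤p)

layeredAt-lowerBound : ∀ γ o {p} → p < sum γ → o ≤ layeredAt γ o p
layeredAt-lowerBound (g ∷ γ) o {p} p<sum with p <? g
... | yes p<g = subst (o ≤_) (sym (layeredAt-head g γ p<g)) (m≤m+n o _)
... | no p≮g  = subst (o ≤_) (sym (layeredAt-tail g γ (≮⇒≥ p≮g)))
  (≤-trans (m≤m+n o g) (layeredAt-lowerBound γ (o + g) (m<n+o∧n≤m⇒m∸n<o p<sum (≮⇒≥ p≮g))))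

layeredAt-unitDescents : ∀ γ o → All (0 <_) γ → UnitDescents (sum γ) (layeredAt γ o)
layeredAt-unitDescents (g ∷ γ) o (_ ∷ positive) {j} sj<sum desc with <-cmp (suc j) g
... | tri< sj<g _ _ = begin
  layeredAt (g ∷ γ) o j       ≡⟨ layeredAt-head g γ (<-trans (n<1+n j) sj<g) ⟩
  o + (g ∸ 1 ∸ j)             ≡⟨ cong (o +_) (+-∸-assoc 1 (<⇒≤pred sj<g)) ⟩
  o + suc (g ∸ 1 ∸ suc j)     ≡⟨ +-suc o _ ⟩
  suc (o + (g ∸ 1 ∸ suc j))   ≡⟨ cong suc (layeredAt-head g γ sj<g) ⟨
  suc (layeredAt (g ∷ γ) o (suc j)) ∎
  where open ≡-Reasoning
... | tri≈ _ sj≡g _ = ⊥-elim (<⇒≱ desc (begin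
  layeredAt (g ∷ γ) o j            ≡⟨ layeredAt-head g γ (subst (j <_) sj≡g (n<1+n j)) ⟩
  o + (g ∸ 1 ∸ j)                  ≤⟨ +-monoʳ-≤ o (≤-trans (m∸n≤m _ j) (m∸n≤m g 1)) ⟩
  o + g                            ≤⟨ layeredAt-lowerBound γ (o + g) (m<n+o∧n≤m⇒m∸n<o sj<sum (≤-reflexive (sym sj≡g))) ⟩
  layeredAt γ (o + g) (suc j ∸ g)  ≡⟨ layeredAt-tail g γ (≤-reflexive (sym sj≡g)) ⟨
  layeredAt (g ∷ γ) o (suc j)      ∎))
  where open ≤-Reasoning
... | tri> _ _ g<sj
  rewrite layeredAt-tail g γ {o} {j} (s≤s⁻¹ g<sj)
        | layeredAt-tail g γ {o} {suc j} (<⇒≤ g<sj)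
        | +-∸-assoc 1 (s≤s⁻¹ g<sj)
  = layeredAt-unitDescents γ (o + g) positive
      (subst (_< sum γ) (+-∸-assoc 1 (s≤s⁻¹ g<sj)) (m<n+o∧n≤m⇒m∸n<o sj<sum (<⇒≤ g<sj))) desc

-- f r = o + (q - r) for s ≤ r ≤ q, stated without truncated subtraction.
LayerOn : (ℕ → ℕ) → ℕ → ℕ → ℕ → Set
LayerOn f o s q = ∀ {r} → s ≤ r → r ≤ q → f r + r ≡ o + q

layerOn-covers : ∀ {f o s q v} → LayerOn f o s q → o ≤ v → v + s ≤ o + q →
  ∃[ r ] s ≤ r × r ≤ q × f r ≡ v
layerOn-covers {f} {o} {s} {q} {v} layer o≤v v+s≤o+q
  with r , v+r≡o+q ← m≤n⇒∃[o]m+o≡n (≤-trans (m≤m+n v s) v+s≤o+q) =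
  r , s≤r , r≤q , +-cancelʳ-≡ r (f r) v (trans (layer s≤r r≤q) (sym v+r≡o+q))
  where
  s≤r : s ≤ r
  s≤r = +-cancelˡ-≤ v s r (subst (v + s ≤_) (sym v+r≡o+q) v+s≤o+q)
  r≤q : r ≤ q
  r≤q = +-cancelˡ-≤ o r q (subst (o + r ≤_) v+r≡o+q (+-monoˡ-≤ r o≤v))

LayeredOn : ℕ → ℕ → (ℕ → ℕ) → Set
LayeredOn N o f =
  Σ (List ℕ) λ γ → IsComposition N γ × (∀ {p} → p < N → f p ≡ layeredAt γ o p)

module FirstLayer {N o f} (bij : IsIntervalBijection N o f) (unit : UnitDescents N f)
                  {q} (q<N : q < N) (fq≡o : f q ≡ o) where
  open IsIntervalBijection bij

  -- Every value below f r is already taken to the right of r, so r is a descent.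
  extendLayer : ∀ {r} → r < q → LayerOn f o (suc r) q → f r + r ≡ o + q
  extendLayer {r} r<q layer = begin
    f r + r               ≡⟨ cong (_+ r) (unit (≤-<-trans r<q q<N) descent) ⟩
    suc (f (suc r)) + r   ≡⟨ +-suc (f (suc r)) r ⟨
    f (suc r) + suc r     ≡⟨ layer ≤-refl r<q ⟩
    o + q                 ∎
    where
    open ≡-Reasoning
    r<N = <-trans r<q q<N
    descent : f (suc r) < f r
    descent = ≰⇒> λ fr≤fsr →
      let r′ , r<r′ , r′≤q , fr′≡fr = layerOn-covers layer (proj₁ (bounded r<N))
                                        (≤-trans (+-monoˡ-≤ (suc r) fr≤fsr) (≤-reflexive (layer ≤-refl r<q)))
      in  <-irrefl (injective r<N (≤-<-trans r′≤q q<N) (sym fr′≡fr)) r<r′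

  layerFrom : ∀ k {r} → r ≤ q → q ≤ r + k → f r + r ≡ o + q
  layerFrom k {r} r≤q q≤r+k with m≤n⇒m<n∨m≡n r≤q
  layerFrom k       _ _       | inj₂ refl = cong (_+ q) fq≡o
  layerFrom zero    {r} _ q≤r+0 | inj₁ r<q = ⊥-elim (<⇒≱ r<q (subst (q ≤_) (+-identityʳ r) q≤r+0))
  layerFrom (suc k) {r} _ q≤r+k | inj₁ r<q = extendLayer r<q λ {r′} r<r′ r′≤q →
    layerFrom k r′≤q (≤-trans q≤r+k (≤-trans (≤-reflexive (+-suc r k)) (+-monoˡ-≤ k r<r′)))

  firstLayer : LayerOn f o 0 q
  firstLayer {r} _ r≤q = layerFrom q r≤q (m≤n+m q r)

  firstLayer-value : ∀ {r} → r ≤ q → f r ≡ o + (q ∸ r)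
  firstLayer-value {r} r≤q = +-cancelʳ-≡ r (f r) (o + (q ∸ r)) (begin
    f r + r            ≡⟨ firstLayer z≤n r≤q ⟩
    o + q              ≡⟨ cong (o +_) (m∸n+n≡m r≤q) ⟨
    o + (q ∸ r + r)    ≡⟨ +-assoc o (q ∸ r) r ⟨
    o + (q ∸ r) + r    ∎)
    where open ≡-Reasoning

  beyondFirstLayer : ∀ {x} → x < N → q < x → o + q < f x
  beyondFirstLayer {x} x<N q<x = ≰⇒> λ fx≤o+q →
    let r , _ , r≤q , fr≡fx = layerOn-covers firstLayer (proj₁ (bounded x<N))
                                (≤-trans (≤-reflexive (+-identityʳ (f x))) fx≤o+q)
    in  <⇒≱ q<x (subst (_≤ q) (injective (≤-<-trans r≤q q<N) x<N fr≡fx) r≤q)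

  shifted : ℕ → ℕ
  shifted p = f (p + suc q)

  shifted-position< : ∀ {p} → p < N ∸ suc q → p + suc q < N
  shifted-position< {p} p<N∸g = m≤o∸n⇒m+n≤o (suc p) q<N p<N∸g

  o+N≡ : o + N ≡ o + suc q + (N ∸ suc q)
  o+N≡ = trans (cong (o +_) (sym (m+[n∸m]≡n q<N))) (sym (+-assoc o (suc q) _))

  shifted-bijection : IsIntervalBijection (N ∸ suc q) (o + suc q) shifted
  shifted-bijection = record
    { bounded    = λ {p} p< →
        subst (_≤ shifted p) (sym (+-suc o q)) (beyondFirstLayer (shifted-position< p<) (m≤n+m (suc q) p)) ,
        subst (shifted p <_) o+N≡ (proj₂ (bounded (shifted-position< p<)))
    ; injective  = λ p< p′< eq → +-cancelʳ-≡ (suc q) _ _ (injective (shifted-position< p<) (shifted-position< p′<) eq)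
    ; surjective = λ {v} o+g≤v v< →
        let x , x<N , fx≡v = surjective (≤-trans (m≤m+n o (suc q)) o+g≤v) (subst (v <_) (sym o+N≡) v<)
            q<x = ≰⇒> λ x≤q → <⇒≱ (subst (_≤ v) (+-suc o q) o+g≤v)
                                   (subst (_≤ o + q) fx≡v (≤-trans (m≤m+n (f x) x) (≤-reflexive (firstLayer z≤n x≤q))))
        in  x ∸ suc q , ∸-monoˡ-< x<N q<x , trans (cong f (m∸n+n≡m q<x)) fx≡v
    }

  shifted-unitDescents : UnitDescents (N ∸ suc q) shifted
  shifted-unitDescents sj< = unit (shifted-position< sj<)

  prependFirstLayer : LayeredOn (N ∸ suc q) (o + suc q) shifted → LayeredOn N o f
  prependFirstLayer (γ , (positive , sum≡) , agrees) =
    suc q ∷ γ , (z<s ∷ positive , trans (cong (suc q +_) sum≡) (m+[n∸m]≡n q<N)) , agreesAll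
    where
    agreesAll : ∀ {p} → p < N → f p ≡ layeredAt (suc q ∷ γ) o p
    agreesAll {p} p<N with p ≤? q
    ... | yes p≤q = trans (firstLayer-value p≤q) (sym (layeredAt-head (suc q) γ (s≤s p≤q)))
    ... | no p≰q  = let q<p = ≰⇒> p≰q in begin
      f p                                 ≡⟨ cong f (m∸n+n≡m q<p) ⟨
      shifted (p ∸ suc q)                 ≡⟨ agrees (∸-monoˡ-< p<N q<p) ⟩
      layeredAt γ (o + suc q) (p ∸ suc q) ≡⟨ layeredAt-tail (suc q) γ q<p ⟨
      layeredAt (suc q ∷ γ) o p           ∎
      where open ≡-Reasoning

unitDescents⇒layered : ∀ {N} → Acc _<_ N → ∀ {o f} →
  IsIntervalBijection N o f → UnitDescents N f → LayeredOn N o f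
unitDescents⇒layered {zero}  _        _   _    = [] , ([] , refl) , λ ()
unitDescents⇒layered {suc M} (acc rs) {o} bij unit =
  let q , q<N , fq≡o = IsIntervalBijection.surjective bij ≤-refl (m<m+n o z<s)
      open FirstLayer bij unit q<N fq≡o
  in  prependFirstLayer (unitDescents⇒layered (rs (∸-monoʳ-< z<s q<N)) shifted-bijection shifted-unitDescents)

Agrees : ∀ {n} → Permutation′ n → (ℕ → ℕ) → Set
Agrees σ f = ∀ i → val σ i ≡ f (toℕ i)

-- σ as a function on ℕ, with the junk value 0 beyond position n.
valℕ : ∀ {n} → Permutation′ n → ℕ → ℕ
valℕ {n} σ p with p <? n
... | yes p<n = val σ (fromℕ< p<n)
... | no _    = 0

module _ {n} (σ : Permutation′ n) where

  valℕ-fromℕ< : ∀ {p} (p<n : p < n) → valℕ σ p ≡ val σ (fromℕ< p<n)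
  valℕ-fromℕ< {p} p<n with p <? n
  ... | yes _   = refl
  ... | no p≮n  = ⊥-elim (p≮n p<n)

  valℕ-agrees : Agrees σ (valℕ σ)
  valℕ-agrees i = trans (cong (val σ) (sym (fromℕ<-toℕ i (toℕ<n i)))) (sym (valℕ-fromℕ< (toℕ<n i)))

  val-injective : ∀ {i j} → val σ i ≡ val σ j → i ≡ j
  val-injective {i} {j} eq = begin
    i                           ≡⟨ inverseˡ σ ⟨
    σ ⟨$⟩ˡ (σ ⟨$⟩ʳ i)           ≡⟨ cong (σ ⟨$⟩ˡ_) (toℕ-injective eq) ⟩
    σ ⟨$⟩ˡ (σ ⟨$⟩ʳ j)           ≡⟨ inverseˡ σ ⟩
    j                           ∎
    where open ≡-Reasoning

  valℕ-bijection : IsIntervalBijection n 0 (valℕ σ)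
  valℕ-bijection = record
    { bounded    = λ p<n → z≤n , subst (_< n) (sym (valℕ-fromℕ< p<n)) (toℕ<n _)
    ; injective  = λ {p} {q} p<n q<n eq → begin
        p                    ≡⟨ toℕ-fromℕ< p<n ⟨
        toℕ (fromℕ< p<n)     ≡⟨ cong toℕ (val-injective (trans (sym (valℕ-fromℕ< p<n)) (trans eq (valℕ-fromℕ< q<n)))) ⟩
        toℕ (fromℕ< q<n)     ≡⟨ toℕ-fromℕ< q<n ⟩
        q                    ∎
    ; surjective = λ {v} _ v<n →
        let i = σ ⟨$⟩ˡ fromℕ< v<n
        in  toℕ i , toℕ<n i , (begin
              valℕ σ (toℕ i)          ≡⟨ valℕ-agrees i ⟨
              toℕ (σ ⟨$⟩ʳ i)          ≡⟨ cong toℕ (inverseʳ σ) ⟩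
              toℕ (fromℕ< v<n)        ≡⟨ toℕ-fromℕ< v<n ⟩
              v                       ∎)
    }
    where open ≡-Reasoning

module _ {n} (σ : Permutation′ n) (f : ℕ → ℕ) (agrees : Agrees σ f) where

  private
    at : ∀ {p} (p<n : p < n) → val σ (fromℕ< p<n) ≡ f p
    at p<n = trans (agrees _) (cong f (toℕ-fromℕ< p<n))

    toℕ-fromℕ<-suc : ∀ {j} (j<n : j < n) (sj<n : suc j < n) →
      toℕ (fromℕ< sj<n) ≡ suc (toℕ (fromℕ< j<n))
    toℕ-fromℕ<-suc j<n sj<n = trans (toℕ-fromℕ< sj<n) (cong suc (sym (toℕ-fromℕ< j<n)))

  contains-3-1b-42 : Contains-3-1b-42′ n f → Contains-3-1b-42 σ
  contains-3-1b-42 (i , j , sj<n , i<j , below , above , noDip) =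
    fromℕ< i<n , fromℕ< j<n , fromℕ< sj<n , toℕ-fromℕ<-suc j<n sj<n ,
    subst₂ _<_ (sym (toℕ-fromℕ< i<n)) (sym (toℕ-fromℕ< j<n)) i<j ,
    subst₂ _<_ (sym (at sj<n)) (sym (at i<n)) below ,
    subst₂ _<_ (sym (at i<n)) (sym (at j<n)) above ,
    λ (k , i<k , k<j , dip) → noDip (toℕ k ,
      subst (_< toℕ k) (toℕ-fromℕ< i<n) i<k ,
      subst (toℕ k <_) (toℕ-fromℕ< j<n) k<j ,
      subst₂ _<_ (agrees k) (at sj<n) dip)
    where
    j<n = <-trans (n<1+n j) sj<n
    i<n = <-trans i<j j<n

  contains-2b-41-3 : Contains-2b-41-3′ n f → Contains-2b-41-3 σ
  contains-2b-41-3 (j , l , sj<l , l<n , below , above , noWitness) =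
    fromℕ< j<n , fromℕ< sj<n , fromℕ< l<n , toℕ-fromℕ<-suc j<n sj<n ,
    subst₂ _<_ (sym (toℕ-fromℕ< sj<n)) (sym (toℕ-fromℕ< l<n)) sj<l ,
    subst₂ _<_ (sym (at sj<n)) (sym (at l<n)) below ,
    subst₂ _<_ (sym (at l<n)) (sym (at j<n)) above ,
    λ (i , i<j , below′ , above′) → noWitness (toℕ i ,
      subst (toℕ i <_) (toℕ-fromℕ< j<n) i<j ,
      subst₂ _<_ (at sj<n) (agrees i) below′ ,
      subst₂ _<_ (agrees i) (at l<n) above′)
    where
    sj<n = <-trans sj<l l<n
    j<n = <-trans (n<1+n j) sj<n

  gapFree⇒avoidsBoth : GapFreeDescents n f → AvoidsBoth σ
  gapFree⇒avoidsBoth gapFree = (λ (_ , j , j′ , e , _ , below , above , _) → insideDescent e below above)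
                             , (λ (j , j′ , _ , e , _ , below , above , _) → insideDescent e below above)
    where
    insideDescent : ∀ {j j′ k} → toℕ j′ ≡ suc (toℕ j) → val σ j′ < val σ k → val σ k < val σ j → ⊥
    insideDescent {j} {j′} {k} e below above =
      gapFree (subst (_< n) e (toℕ<n j′)) (toℕ<n k)
              (subst₂ _<_ (trans (agrees j′) (cong f e)) (agrees k) below)
              (subst₂ _<_ (agrees k) (agrees j) above)

mainTheorem20 : ∀ (n : ℕ) (σ : Permutation′ n) → AvoidsBoth σ ⇔ IsLayered σ
mainTheorem20 n σ = mk⇔ toLayered fromLayered
  where
  toLayered : AvoidsBoth σ → IsLayered σ
  toLayered (no-3-1b-42 , no-2b-41-3) =
    let bij = valℕ-bijection σ
        gapFree = avoiding⇒gapFree (IsIntervalBijection.injective bij)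
                    (no-3-1b-42 ∘ contains-3-1b-42 σ (valℕ σ) (valℕ-agrees σ))
                    (no-2b-41-3 ∘ contains-2b-41-3 σ (valℕ σ) (valℕ-agrees σ))
        γ , composition , agrees = unitDescents⇒layered (<-wellFounded n) bij (gapFree⇒unitDescents bij gapFree)
    in  γ , composition , λ p → trans (valℕ-agrees σ p) (agrees (toℕ<n p))

  fromLayered : IsLayered σ → AvoidsBoth σ
  fromLayered (γ , (positive , sum≡n) , agrees) =
    gapFree⇒avoidsBoth σ (layered γ) agrees (subst (λ N → GapFreeDescents N (layered γ)) sum≡n
      (unitDescents⇒gapFree (layeredAt-unitDescents γ 0 positive)))
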